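{- Let $k\ge2$, $2\le i\le k$ and $n\ge3$ be integers and $\iota=\sqrt{ -1}$. For $\lambda\in\{1,2\}$ and $m\ge1$ let $H_{k,m}=(h_{st})$ be the $m\times m$ matrix with $h_{st}=\iota^{s-t}$ if $-1\le s-t<k$ and $s\ne t$, $h_{ss}=\lambda$, $h_{st}=0$ otherwise, and let $H_{k,n}^{i}$ be the $n\times n$ matrix whose first row is $(1,-\iota,0,\dots,0)$, whose first column has entry $\iota^{r-1}$ in row $r$ for $1\le r\le\min(n,k-i+1)$ and $0$ in the remaining rows, and whose submatrix obtained by deleting the first row and column is $H_{k,n-1}$. Then $\operatorname{per}(H_{k,n}^{i})=f_{k,n}^{i}$ when $\lambda=1$, and $\operatorname{per}(H_{k,n}^{i})=p_{k,n}^{i}$ when $\lambda=2$, where $\operatorname{per}$ denotes the permanent and $f,p$ are as in the context.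
   Context: For a positive integer $k$ and $1\le i\le k$, the sequences $(f_{k,n}^{i})_{n\ge1-k}$ (generalized order-$k$ Fibonacci) and $(p_{k,n}^{i})_{n\ge1-k}$ (generalized order-$k$ Pell) have initial values equal to $1$ if $i=1-n$ and $0$ otherwise, for $1-k\le n\le 0$, and satisfy for $n\ge1$ the recurrences $f_{k,n}^{i}=f_{k,n-1}^{i}+f_{k,n-2}^{i}+\cdots+f_{k,n-k}^{i}$ and $p_{k,n}^{i}=2p_{k,n-1}^{i}+p_{k,n-2}^{i}+\cdots+p_{k,n-k}^{i}$. -}

module Defs where

open import Data.Nat as ℕ using (ℕ; zero; suc; _≤_; _≤ᵇ_; _⊓_; _∸_; _≡ᵇ_)
open import Data.Integer as ℤ using (ℤ; +_; -[1+_])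
open import Data.Fin as Fin using (Fin; zero; suc; toℕ)
open import Data.Fin.Properties using () renaming (_≟_ to _≟F_)
open import Data.Vec as Vec using (Vec; []; _∷_; lookup; toList)
open import Data.List as List using (List; []; _∷_; _++_; concatMap; filter; map; allFin; foldr)
open import Data.Bool using (Bool; true; false; if_then_else_; _∧_)
open import Relation.Nullary using (yes; no)
import Data.List.Relation.Unary.Unique.DecPropositional as UDec
open import Data.Nat.ListAction using (sum)

-- Gaussian integers ℤ[ι] ⊂ ℂ (all matrix entries lie here)

record G : Set where
  constructor _+ι_
  field
    re : ℤ
    im : ℤ
open G public

0G 1G ιG : G
0G = (+ 0) +ι (+ 0)
1G = (+ 1) +ι (+ 0)
ιG = (+ 0) +ι (+ 1)

_+G_ : G → G → G
(a +ι b) +G (c +ι d) = (a ℤ.+ c) +ι (b ℤ.+ d)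

_*G_ : G → G → G
(a +ι b) *G (c +ι d) = ((a ℤ.* c) ℤ.- (b ℤ.* d)) +ι ((a ℤ.* d) ℤ.+ (b ℤ.* c))

-G_ : G → G
-G (a +ι b) = (ℤ.- a) +ι (ℤ.- b)

fromℤ : ℤ → G
fromℤ a = a +ι (+ 0)

fromℕ : ℕ → G
fromℕ n = fromℤ (+ n)

-- ι ^ d for an integer exponent d (ι⁻¹ = -ι)
ιpow : ℤ → G
ιpow (+ zero) = 1G
ιpow (+ suc n) = ιG *G ιpow (+ n)
ιpow -[1+ zero ] = -G ιG
ιpow -[1+ suc n ] = (-G ιG) *G ιpow -[1+ n ]

Matrix : ℕ → Set
Matrix m = Fin m → Fin m → G

sumG : List G → G
sumG = foldr _+G_ 0G

prodG : List G → G
prodG = foldr _*G_ 1G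

allVecs : (m n : ℕ) → List (Vec (Fin m) n)
allVecs m zero = [] ∷ []
allVecs m (suc n) = concatMap (λ x → map (x ∷_) (allVecs m n)) (allFin m)

-- the permutations of Fin n, as the injective maps Fin n → Fin n
perms : (n : ℕ) → List (Vec (Fin n) n)
perms n = filter (λ v → UDec.unique? (_≟F_ {n}) (toList v)) (allVecs n n)

per : {n : ℕ} → Matrix n → G
per {n} A = sumG (map (λ σ → prodG (map (λ s → A s (lookup σ s)) (allFin n))) (perms n))

-- The matrices of the statement (indices 0-based; differences unchanged)

H : (λ' : ℤ) (k m : ℕ) → Matrix m
H λ' k m s t with toℕ s ℕ.≟ toℕ t
... | yes _ = fromℤ λ'
... | no _ =
  let d = (+ toℕ s) ℤ.- (+ toℕ t) in
  if (ℤ.-1ℤ ℤ.≤ᵇ d) ∧ ((d ℤ.+ ℤ.1ℤ) ℤ.≤ᵇ (+ k)) then ιpow d else 0G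

Hi : (λ' : ℤ) (k i n : ℕ) → Matrix n
Hi λ' k i (suc m) zero zero = 1G
Hi λ' k i (suc m) zero (suc zero) = -G ιG
Hi λ' k i (suc m) zero (suc (suc _)) = 0G
Hi λ' k i (suc m) (suc r) zero =
  -- 1-based row index is toℕ r + 2
  if (toℕ r ℕ.+ 2) ≤ᵇ (suc m ⊓ (k ∸ i ℕ.+ 1)) then ιpow (+ (toℕ r ℕ.+ 1)) else 0G
Hi λ' k i (suc m) (suc a) (suc b) = H λ' k m a b

-- Generalized order-k sequences with recurrence
--   x_n = c·x_{n-1} + x_{n-2} + … + x_{n-k}   (n ≥ 1),
-- initial values x_n = 1 if i = 1-n, else 0, for 1-k ≤ n ≤ 0.
-- c = 1: order-k Fibonacci f^i_{k,n};  c = 2: order-k Pell p^i_{k,n}.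

-- window n = [x_n, x_{n-1}, …, x_{n-k+1}]
window : (c k i : ℕ) → ℕ → List ℕ
window c k i zero = List.map (λ r → if r ≡ᵇ (i ∸ 1) then 1 else 0) (List.upTo k)
window c k i (suc n) with window c k i n
... | [] = []
... | (x ∷ xs) = (c ℕ.* x ℕ.+ sum xs) ∷ List.take (k ∸ 1) (x ∷ xs)

genSeq : (c k i : ℕ) → ℕ → ℕ
genSeq c k i n with window c k i n
... | [] = 0
... | (x ∷ _) = x

fib : (k i n : ℕ) → ℕ
fib = genSeq 1

pell : (k i n : ℕ) → ℕ
pell = genSeq 2

-- Expand the permanent along first rows. Let M(r,c), for c ≤ r, be the submatrix of H^i_{k,n}
-- on rows r, r+1, … and columns c, r+1, r+2, …. As H^i is upper Hessenberg with
-- superdiagonal -ι, the first row of M(r,c) is nonzero only in columns c and r+1, so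
--   per M(r,c) = h_{rc} · per M(r+1,r+1) - ι · per M(r+1,c).
-- By induction on the number j of rows, per M(r,c) = ι^(r-c) · x^{d+1}_j for an index
-- d = d(r,c), where x^i is the order-k sequence whose initial window is the unit vector
-- e_{i-1}. The recursion is matched by x^{d+1}_{j+1} = a_d x^1_j + x^{d+2}_j, a_d being the
-- coefficient of x_{n-1-d} in the recurrence; this holds because the recurrence is linear
-- and one step of it maps the window e_d to a_d e_0 + e_{d+1}. Finally H^i = M(0,0) and
-- d(0,0) = i - 1.
module Submission where

open import Defs
open import Data.Nat as ℕ using (ℕ; zero; suc; _+_; _*_; _∸_; _≤_; _<_; _≤ᵇ_; _<ᵇ_; _≡ᵇ_; _⊓_; s≤s; z≤n)
open import Data.Nat.Properties
  using ( +-identityʳ; *-identityʳ; *-zeroʳ; +-comm; +-assoc; +-suc; suc-injective; n≤1+n; n<1+n; ≤-refl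
        ; m≤n⇒m≤1+n; <⇒≤; <⇒≢; <⇒≱; ≰⇒>; ≤∧≢⇒<; <-trans; ≤-<-trans; m<m+n; +-monoˡ-≤; +-cancelʳ-≤
        ; m≤n⇒m⊓n≡m; m≤n⊓o⇒m≤o; ⊓-glb; n∸n≡0; m+n∸n≡m; +-∸-assoc; m<n⇒0<n∸m; m+n≤o⇒m≤o∸n; m≤o∸n⇒m+n≤o
        ; ≡ᵇ⇒≡; <ᵇ⇒<; <⇒<ᵇ; ≤ᵇ⇒≤; ≤⇒≤ᵇ )
open import Data.Nat.ListAction using (sum)
import Data.Nat.Tactic.RingSolver as ℕ-Solver
open import Data.Integer as ℤ using (+_)
import Data.Integer.Properties as ℤP
import Data.Integer.Tactic.RingSolver as ℤ-Solver
open import Data.Fin using (Fin; zero; suc; toℕ; fromℕ<)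
open import Data.Fin.Properties using (toℕ-injective; toℕ-fromℕ<; toℕ<n) renaming (_≟_ to _≟F_)
import Data.Fin.Properties as Finₚ
open import Data.Vec using (Vec; []; _∷_; lookup; toList)
open import Data.List as List using (List; []; _∷_; _++_; concat; filter; map; allFin; tabulate; take; zipWith; replicate; length; applyUpTo)
open import Data.List.Properties using (map-tabulate; map-cong; map-∘; map-++; map-applyUpTo; length-take; length-replicate; length-map; length-upTo)
open import Data.List.Relation.Unary.All using (all?)
import Data.List.Relation.Unary.Unique.DecPropositional as Unique
open import Data.Bool using (Bool; true; false; if_then_else_; T; _∧_; _∨_)
open import Data.Bool.Properties using (T-≡; ∨-zeroʳ)
open import Data.Product using (_×_; _,_)
open import Data.Empty using (⊥-elim)
open import Data.Unit using (tt)
open import Relation.Nullary using (Dec; yes; no; does; ¬?)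
open import Relation.Binary.PropositionalEquality
open import Function using (_∘_; id)
open import Function.Bundles using (Equivalence)

+G-identityˡ : ∀ x → 0G +G x ≡ x
+G-identityˡ (a +ι b) = cong₂ _+ι_ (ℤP.+-identityˡ a) (ℤP.+-identityˡ b)

+G-identityʳ : ∀ x → x +G 0G ≡ x
+G-identityʳ (a +ι b) = cong₂ _+ι_ (ℤP.+-identityʳ a) (ℤP.+-identityʳ b)

+G-assoc : ∀ x y z → (x +G y) +G z ≡ x +G (y +G z)
+G-assoc (a +ι b) (c +ι d) (e +ι f) = cong₂ _+ι_ (ℤP.+-assoc a c e) (ℤP.+-assoc b d f)

+G-comm : ∀ x y → x +G y ≡ y +G x
+G-comm (a +ι b) (c +ι d) = cong₂ _+ι_ (ℤP.+-comm a c) (ℤP.+-comm b d)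

*G-zeroˡ : ∀ x → 0G *G x ≡ 0G
*G-zeroˡ (a +ι b) rewrite ℤP.*-zeroˡ a | ℤP.*-zeroˡ b = refl

*G-zeroʳ : ∀ x → x *G 0G ≡ 0G
*G-zeroʳ (a +ι b) rewrite ℤP.*-zeroʳ a | ℤP.*-zeroʳ b = refl

*G-identityˡ : ∀ x → 1G *G x ≡ x
*G-identityˡ (a +ι b) rewrite ℤP.*-identityˡ a | ℤP.*-identityˡ b | ℤP.*-zeroˡ a | ℤP.*-zeroˡ b
  | ℤP.+-identityʳ a | ℤP.+-identityʳ b = refl

*G-identityʳ : ∀ x → x *G 1G ≡ x
*G-identityʳ (a +ι b) rewrite ℤP.*-identityʳ a | ℤP.*-identityʳ b | ℤP.*-zeroʳ a | ℤP.*-zeroʳ b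
  | ℤP.+-identityʳ a | ℤP.+-identityˡ b = refl

*G-assoc : ∀ x y z → (x *G y) *G z ≡ x *G (y *G z)
*G-assoc (a +ι b) (c +ι d) (e +ι f) = cong₂ _+ι_ (real-part a b c d e f) (imag-part a b c d e f)
  where
  real-part : ∀ a b c d e f → (a ℤ.* c ℤ.- b ℤ.* d) ℤ.* e ℤ.- (a ℤ.* d ℤ.+ b ℤ.* c) ℤ.* f ≡ a ℤ.* (c ℤ.* e ℤ.- d ℤ.* f) ℤ.- b ℤ.* (c ℤ.* f ℤ.+ d ℤ.* e)
  real-part = ℤ-Solver.solve-∀
  imag-part : ∀ a b c d e f → (a ℤ.* c ℤ.- b ℤ.* d) ℤ.* f ℤ.+ (a ℤ.* d ℤ.+ b ℤ.* c) ℤ.* e ≡ a ℤ.* (c ℤ.* f ℤ.+ d ℤ.* e) ℤ.+ b ℤ.* (c ℤ.* e ℤ.- d ℤ.* f)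
  imag-part = ℤ-Solver.solve-∀

*G-distribˡ-+G : ∀ x y z → x *G (y +G z) ≡ (x *G y) +G (x *G z)
*G-distribˡ-+G (a +ι b) (c +ι d) (e +ι f) = cong₂ _+ι_ (real-part a b c d e f) (imag-part a b c d e f)
  where
  real-part : ∀ a b c d e f → a ℤ.* (c ℤ.+ e) ℤ.- b ℤ.* (d ℤ.+ f) ≡ (a ℤ.* c ℤ.- b ℤ.* d) ℤ.+ (a ℤ.* e ℤ.- b ℤ.* f)
  real-part = ℤ-Solver.solve-∀
  imag-part : ∀ a b c d e f → a ℤ.* (d ℤ.+ f) ℤ.+ b ℤ.* (c ℤ.+ e) ≡ (a ℤ.* d ℤ.+ b ℤ.* c) ℤ.+ (a ℤ.* f ℤ.+ b ℤ.* e)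
  imag-part = ℤ-Solver.solve-∀

ι-cancel : ∀ x z → (-G ιG) *G ((ιG *G x) *G z) ≡ x *G z
ι-cancel x z = begin
  (-G ιG) *G ((ιG *G x) *G z) ≡⟨ cong ((-G ιG) *G_) (*G-assoc ιG x z) ⟩
  (-G ιG) *G (ιG *G (x *G z)) ≡⟨ sym (*G-assoc (-G ιG) ιG (x *G z)) ⟩
  1G *G (x *G z)              ≡⟨ *G-identityˡ (x *G z) ⟩
  x *G z                      ∎
  where open ≡-Reasoning

fromℕ-+ : ∀ a b → fromℕ (a + b) ≡ fromℕ a +G fromℕ b
fromℕ-+ a b = cong (_+ι (+ 0)) (ℤP.pos-+ a b)

fromℕ-* : ∀ a b → fromℕ (a * b) ≡ fromℕ a *G fromℕ b
fromℕ-* a b rewrite ℤP.*-zeroʳ (+ a) = cong (_+ι (+ 0)) (trans (ℤP.pos-* a b) (sym (ℤP.+-identityʳ _)))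

if-as-factor : ∀ b x → (if b then x else 0G) ≡ x *G fromℕ (if b then 1 else 0)
if-as-factor true x = sym (*G-identityʳ x)
if-as-factor false x = sym (*G-zeroʳ x)

sumG-++ : ∀ xs ys → sumG (xs ++ ys) ≡ sumG xs +G sumG ys
sumG-++ [] ys = sym (+G-identityˡ _)
sumG-++ (x ∷ xs) ys = trans (cong (x +G_) (sumG-++ xs ys)) (sym (+G-assoc x _ _))

sumG-map-concat : ∀ {A : Set} (g : A → G) (xss : List (List A)) →
  sumG (map g (concat xss)) ≡ sumG (map (sumG ∘ map g) xss)
sumG-map-concat g [] = refl
sumG-map-concat g (xs ∷ xss) = begin
  sumG (map g (xs ++ concat xss))              ≡⟨ cong sumG (map-++ g xs (concat xss)) ⟩
  sumG (map g xs ++ map g (concat xss))        ≡⟨ sumG-++ (map g xs) _ ⟩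
  sumG (map g xs) +G sumG (map g (concat xss)) ≡⟨ cong (sumG (map g xs) +G_) (sumG-map-concat g xss) ⟩
  sumG (map (sumG ∘ map g) (xs ∷ xss))         ∎
  where open ≡-Reasoning

sumG-map-filter : ∀ {A : Set} {P : A → Set} (P? : ∀ a → Dec (P a)) (g : A → G) xs →
  sumG (map g (filter P? xs)) ≡ sumG (map (λ a → if does (P? a) then g a else 0G) xs)
sumG-map-filter P? g [] = refl
sumG-map-filter P? g (x ∷ xs) with does (P? x)
... | true  = cong (g x +G_) (sumG-map-filter P? g xs)
... | false = trans (sumG-map-filter P? g xs) (sym (+G-identityˡ _))

sumG-map-*G : ∀ {A : Set} a (g : A → G) xs → sumG (map (λ x → a *G g x) xs) ≡ a *G sumG (map g xs)
sumG-map-*G a g [] = sym (*G-zeroʳ a)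
sumG-map-*G a g (x ∷ xs) = trans (cong ((a *G g x) +G_) (sumG-map-*G a g xs)) (sym (*G-distribˡ-+G a _ _))

sumG-tabulate-zero : ∀ {m} (f : Fin m → G) → (∀ x → f x ≡ 0G) → sumG (tabulate f) ≡ 0G
sumG-tabulate-zero {zero} f f≡0 = refl
sumG-tabulate-zero {suc m} f f≡0 =
  trans (cong₂ _+G_ (f≡0 zero) (sumG-tabulate-zero (f ∘ suc) (f≡0 ∘ suc))) (+G-identityˡ 0G)

sumG-tabulate-single : ∀ {m} (f : Fin m → G) p → (∀ x → x ≢ p → f x ≡ 0G) → sumG (tabulate f) ≡ f p
sumG-tabulate-single {suc m} f zero f≡0 =
  trans (cong (f zero +G_) (sumG-tabulate-zero (f ∘ suc) (λ x → f≡0 (suc x) λ ()))) (+G-identityʳ (f zero))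
sumG-tabulate-single {suc m} f (suc p) f≡0 =
  trans (cong₂ _+G_ (f≡0 zero λ ()) (sumG-tabulate-single (f ∘ suc) p (λ x x≢p → f≡0 (suc x) (x≢p ∘ Finₚ.suc-injective))))
        (+G-identityˡ (f (suc p)))

sumG-tabulate-pair : ∀ {m} (f : Fin m → G) p q → p ≢ q → (∀ x → x ≢ p → x ≢ q → f x ≡ 0G) →
  sumG (tabulate f) ≡ f p +G f q
sumG-tabulate-pair {suc m} f zero zero p≢q f≡0 = ⊥-elim (p≢q refl)
sumG-tabulate-pair {suc m} f zero (suc q) p≢q f≡0 =
  cong (f zero +G_) (sumG-tabulate-single (f ∘ suc) q (λ x x≢q → f≡0 (suc x) (λ ()) (x≢q ∘ Finₚ.suc-injective)))
sumG-tabulate-pair {suc m} f (suc p) zero p≢q f≡0 =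
  trans (cong (f zero +G_) (sumG-tabulate-single (f ∘ suc) p (λ x x≢p → f≡0 (suc x) (x≢p ∘ Finₚ.suc-injective) (λ ()))))
        (+G-comm (f zero) (f (suc p)))
sumG-tabulate-pair {suc m} f (suc p) (suc q) p≢q f≡0 =
  trans (cong₂ _+G_ (f≡0 zero (λ ()) (λ ()))
          (sumG-tabulate-pair (f ∘ suc) p q (p≢q ∘ cong suc)
            (λ x x≢p x≢q → f≡0 (suc x) (x≢p ∘ Finₚ.suc-injective) (x≢q ∘ Finₚ.suc-injective))))
        (+G-identityˡ _)

≢-fromℕ< : ∀ {m a} {x : Fin m} (a<m : a < m) → x ≢ fromℕ< a<m → toℕ x ≢ a
≢-fromℕ< a<m x≢ x≡a = x≢ (toℕ-injective (trans x≡a (sym (toℕ-fromℕ< a<m))))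

RectMatrix : ℕ → ℕ → Set
RectMatrix j m = Fin j → Fin m → G

prodAlong : ∀ {j m} → RectMatrix j m → Vec (Fin m) j → G
prodAlong B [] = 1G
prodAlong B (y ∷ w) = B zero y *G prodAlong (B ∘ suc) w

injections : (j m : ℕ) → List (Vec (Fin m) j)
injections j m = filter (λ v → Unique.unique? (_≟F_ {m}) (toList v)) (allVecs m j)

rectPer : ∀ {j m} → RectMatrix j m → G
rectPer {j} {m} B = sumG (map (prodAlong B) (injections j m))

per≡rectPer : ∀ {n} (A : Matrix n) → per A ≡ rectPer A
per≡rectPer {n} A = cong sumG (map-cong prodG≡prodAlong (injections n n))
  where
  prodG-tabulate : ∀ {j m} (B : RectMatrix j m) σ → prodG (tabulate (λ s → B s (lookup σ s))) ≡ prodAlong B σ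
  prodG-tabulate B [] = refl
  prodG-tabulate B (y ∷ w) = cong (B zero y *G_) (prodG-tabulate (B ∘ suc) w)

  prodG≡prodAlong : ∀ σ → prodG (map (λ s → A s (lookup σ s)) (allFin n)) ≡ prodAlong A σ
  prodG≡prodAlong σ = trans (cong prodG (map-tabulate id (λ s → A s (lookup σ s)))) (prodG-tabulate A σ)

rectPer-cong : ∀ {j m} {B B′ : RectMatrix j m} → (∀ s t → B s t ≡ B′ s t) → rectPer B ≡ rectPer B′
rectPer-cong {j} {m} B≡B′ = cong sumG (map-cong (prodAlong-cong B≡B′) (injections j m))
  where
  prodAlong-cong : ∀ {j} {B B′ : RectMatrix j m} → (∀ s t → B s t ≡ B′ s t) → ∀ w → prodAlong B w ≡ prodAlong B′ w
  prodAlong-cong B≡B′ [] = refl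
  prodAlong-cong B≡B′ (y ∷ w) = cong₂ _*G_ (B≡B′ zero y) (prodAlong-cong (B≡B′ ∘ suc) w)

-- Zeroing column x stands in for deleting it: a tuple that hits x again then contributes 0.
deleteCol : ∀ {j m} → Fin m → RectMatrix j m → RectMatrix j m
deleteCol x B s t = if does (x ≟F t) then 0G else B s t

prodAlong-deleteCol : ∀ {j m} (x : Fin m) (B : RectMatrix j m) w →
  prodAlong (deleteCol x B) w ≡ (if does (all? (λ y → ¬? (x ≟F y)) (toList w)) then prodAlong B w else 0G)
prodAlong-deleteCol x B [] = refl
prodAlong-deleteCol x B (y ∷ w) with x ≟F y
... | yes _ = *G-zeroˡ (prodAlong (deleteCol x (B ∘ suc)) w)
... | no _ with does (all? (λ y → ¬? (x ≟F y)) (toList w)) | prodAlong-deleteCol x (B ∘ suc) w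
...   | true  | ih = cong (B zero y *G_) ih
...   | false | ih = trans (cong (B zero y *G_) ih) (*G-zeroʳ (B zero y))

rectPer-expand : ∀ {j m} (B : RectMatrix (suc j) m) →
  rectPer B ≡ sumG (tabulate (λ x → B zero x *G rectPer (deleteCol x (B ∘ suc))))
rectPer-expand {j} {m} B = begin
  rectPer B
    ≡⟨ sumG-map-filter injective? (prodAlong B) (allVecs m (suc j)) ⟩
  sumG (map F (concat (map (λ x → map (x ∷_) (allVecs m j)) (allFin m))))
    ≡⟨ sumG-map-concat F (map (λ x → map (x ∷_) (allVecs m j)) (allFin m)) ⟩
  sumG (map (sumG ∘ map F) (map (λ x → map (x ∷_) (allVecs m j)) (allFin m)))
    ≡⟨ cong sumG (sym (map-∘ (allFin m))) ⟩
  sumG (map (λ x → sumG (map F (map (x ∷_) (allVecs m j)))) (allFin m))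
    ≡⟨ cong sumG (map-cong row-term (allFin m)) ⟩
  sumG (map (λ x → B zero x *G rectPer (deleteCol x (B ∘ suc))) (allFin m))
    ≡⟨ cong sumG (map-tabulate id (λ x → B zero x *G rectPer (deleteCol x (B ∘ suc)))) ⟩
  sumG (tabulate (λ x → B zero x *G rectPer (deleteCol x (B ∘ suc))))
    ∎
  where
  open ≡-Reasoning
  injective? : ∀ {k} (v : Vec (Fin m) k) → Dec (Unique.Unique (_≟F_ {m}) (toList v))
  injective? v = Unique.unique? (_≟F_ {m}) (toList v)

  F : Vec (Fin m) (suc j) → G
  F v = if does (injective? v) then prodAlong B v else 0G

  -- unique? (x ∷ w) computes to (x ∉ w) ∧ unique? w
  split : ∀ (fresh inj : Bool) (P b : G) →
    (if fresh ∧ inj then b *G P else 0G) ≡ b *G (if inj then (if fresh then P else 0G) else 0G)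
  split true  true  P b = refl
  split true  false P b = sym (*G-zeroʳ b)
  split false true  P b = sym (*G-zeroʳ b)
  split false false P b = sym (*G-zeroʳ b)

  F-cons : ∀ x w → F (x ∷ w) ≡ B zero x *G (if does (injective? w) then prodAlong (deleteCol x (B ∘ suc)) w else 0G)
  F-cons x w =
    trans (split (does (all? (λ y → ¬? (x ≟F y)) (toList w))) (does (injective? w)) (prodAlong (B ∘ suc) w) (B zero x))
          (cong (λ p → B zero x *G (if does (injective? w) then p else 0G)) (sym (prodAlong-deleteCol x (B ∘ suc) w)))

  row-term : ∀ x → sumG (map F (map (x ∷_) (allVecs m j))) ≡ B zero x *G rectPer (deleteCol x (B ∘ suc))
  row-term x = begin
    sumG (map F (map (x ∷_) (allVecs m j)))
      ≡⟨ cong sumG (sym (map-∘ (allVecs m j))) ⟩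
    sumG (map (λ w → F (x ∷ w)) (allVecs m j))
      ≡⟨ cong sumG (map-cong (F-cons x) (allVecs m j)) ⟩
    sumG (map (λ w → B zero x *G (if does (injective? w) then prodAlong (deleteCol x (B ∘ suc)) w else 0G)) (allVecs m j))
      ≡⟨ sumG-map-*G (B zero x) _ (allVecs m j) ⟩
    B zero x *G sumG (map (λ w → if does (injective? w) then prodAlong (deleteCol x (B ∘ suc)) w else 0G) (allVecs m j))
      ≡⟨ cong (B zero x *G_) (sym (sumG-map-filter injective? _ (allVecs m j))) ⟩
    B zero x *G rectPer (deleteCol x (B ∘ suc))
      ∎

masked : ∀ {j m} → (ℕ → Bool) → RectMatrix j m → RectMatrix j m
masked alive B s t = if alive (toℕ t) then B s t else 0G

deleteCol-masked : ∀ {j m} (x : Fin m) {a a′ : ℕ → Bool} {B B′ : RectMatrix j m} →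
  a′ (toℕ x) ≡ false → (∀ t → t ≢ toℕ x → a t ≡ a′ t) → (∀ s t → B s t ≡ B′ s t) →
  ∀ s t → deleteCol x (masked a B) s t ≡ masked a′ B′ s t
deleteCol-masked x a′x≡false a≡a′ B≡B′ s t with x ≟F t
... | yes refl rewrite a′x≡false = refl
... | no x≢t rewrite a≡a′ (toℕ t) (x≢t ∘ sym ∘ toℕ-injective) | B≡B′ s t = refl

step : ℕ → ℕ → List ℕ → List ℕ
step c k [] = []
step c k (x ∷ xs) = (c * x + sum xs) ∷ take (k ∸ 1) (x ∷ xs)

window-suc : ∀ c k i n → window c k i (suc n) ≡ step c k (window c k i n)
window-suc c k i n with window c k i n
... | [] = refl
... | x ∷ xs = refl

head₀ : List ℕ → ℕ
head₀ [] = 0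
head₀ (x ∷ _) = x

genSeq≡head₀ : ∀ c k i n → genSeq c k i n ≡ head₀ (window c k i n)
genSeq≡head₀ c k i n with window c k i n
... | [] = refl
... | x ∷ _ = refl

length-step : ∀ c k v → length v ≡ suc k → length (step c (suc k) v) ≡ suc k
length-step c k (x ∷ xs) len = cong suc (begin
  length (take k (x ∷ xs)) ≡⟨ length-take k (x ∷ xs) ⟩
  k ⊓ length (x ∷ xs)    ≡⟨ cong (k ⊓_) len ⟩
  k ⊓ suc k              ≡⟨ m≤n⇒m⊓n≡m (n≤1+n k) ⟩
  k                        ∎)
  where open ≡-Reasoning

length-window : ∀ c k i n → length (window c (suc k) i n) ≡ suc k
length-window c k i zero = trans (length-map _ (List.upTo (suc k))) (length-upTo (suc k))
length-window c k i (suc n) =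
  trans (cong length (window-suc c (suc k) i n)) (length-step c k (window c (suc k) i n) (length-window c k i n))

length-window-indep : ∀ c k i i′ n → length (window c (suc k) i n) ≡ length (window c (suc k) i′ n)
length-window-indep c k i i′ n = trans (length-window c k i n) (sym (length-window c k i′ n))

scaleAdd : ℕ → List ℕ → List ℕ → List ℕ
scaleAdd α = zipWith (λ x y → α * x + y)

sum-scaleAdd : ∀ α v w → length v ≡ length w → sum (scaleAdd α v w) ≡ α * sum v + sum w
sum-scaleAdd α [] [] _ = sym (cong (_+ 0) (*-zeroʳ α))
sum-scaleAdd α (x ∷ xs) (y ∷ ys) len =
  trans (cong (λ s → α * x + y + s) (sum-scaleAdd α xs ys (suc-injective len))) (distrib α x y (sum xs) (sum ys))
  where
  distrib : ∀ α x y a b → α * x + y + (α * a + b) ≡ α * (x + a) + (y + b)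
  distrib = ℕ-Solver.solve-∀

take-scaleAdd : ∀ α n v w → take n (scaleAdd α v w) ≡ scaleAdd α (take n v) (take n w)
take-scaleAdd α zero v w = refl
take-scaleAdd α (suc n) [] w = refl
take-scaleAdd α (suc n) (x ∷ xs) [] = refl
take-scaleAdd α (suc n) (x ∷ xs) (y ∷ ys) = cong (α * x + y ∷_) (take-scaleAdd α n xs ys)

step-scaleAdd : ∀ c k α v w → length v ≡ length w → step c k (scaleAdd α v w) ≡ scaleAdd α (step c k v) (step c k w)
step-scaleAdd c k α [] [] _ = refl
step-scaleAdd c k α (x ∷ xs) (y ∷ ys) len =
  cong₂ _∷_ (trans (cong (λ s → c * (α * x + y) + s) (sum-scaleAdd α xs ys (suc-injective len)))
                   (distrib c α x y (sum xs) (sum ys)))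
            (take-scaleAdd α (k ∸ 1) (x ∷ xs) (y ∷ ys))
  where
  distrib : ∀ c α x y a b → c * (α * x + y) + (α * a + b) ≡ α * (c * x + a) + (c * y + b)
  distrib = ℕ-Solver.solve-∀

head₀-scaleAdd : ∀ α v w → length v ≡ length w → head₀ (scaleAdd α v w) ≡ α * head₀ v + head₀ w
head₀-scaleAdd α [] [] _ = sym (cong (_+ 0) (*-zeroʳ α))
head₀-scaleAdd α (x ∷ xs) (y ∷ ys) _ = refl

scaleAdd-zerosˡ : ∀ α {n} w → length w ≡ n → scaleAdd α (replicate n 0) w ≡ w
scaleAdd-zerosˡ α [] refl = refl
scaleAdd-zerosˡ α (y ∷ ys) refl = cong₂ _∷_ (cong (_+ y) (*-zeroʳ α)) (scaleAdd-zerosˡ α ys refl)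

unitVec : ℕ → ℕ → List ℕ
unitVec zero d = []
unitVec (suc k) zero = 1 ∷ replicate k 0
unitVec (suc k) (suc d) = 0 ∷ unitVec k d

length-unitVec : ∀ k d → length (unitVec k d) ≡ k
length-unitVec zero d = refl
length-unitVec (suc k) zero = cong suc (length-replicate k)
length-unitVec (suc k) (suc d) = cong suc (length-unitVec k d)

sum-zeros : ∀ k → sum (replicate k 0) ≡ 0
sum-zeros zero = refl
sum-zeros (suc k) = sum-zeros k

sum-unitVec : ∀ k d → sum (unitVec k d) ≡ (if d <ᵇ k then 1 else 0)
sum-unitVec zero d = refl
sum-unitVec (suc k) zero = cong suc (sum-zeros k)
sum-unitVec (suc k) (suc d) = sum-unitVec k d

take-zeros : ∀ k → take k (replicate (suc k) 0) ≡ replicate k 0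
take-zeros zero = refl
take-zeros (suc k) = cong (0 ∷_) (take-zeros k)

take-unitVec : ∀ k d → take k (unitVec (suc k) d) ≡ unitVec k d
take-unitVec zero d = refl
take-unitVec (suc k) zero = cong (1 ∷_) (take-zeros k)
take-unitVec (suc k) (suc d) = cong (0 ∷_) (take-unitVec k d)

window-zero : ∀ c k d → window c k (suc d) 0 ≡ unitVec k d
window-zero c k d = trans (map-applyUpTo (λ r → r) indicator k) (applyUpTo-indicator k d)
  where
  indicator : ℕ → ℕ
  indicator r = if r ≡ᵇ d then 1 else 0

  applyUpTo-zeros : ∀ k → applyUpTo (λ _ → 0) k ≡ replicate k 0
  applyUpTo-zeros zero = refl
  applyUpTo-zeros (suc k) = cong (0 ∷_) (applyUpTo-zeros k)

  applyUpTo-indicator : ∀ k d → applyUpTo (λ r → if r ≡ᵇ d then 1 else 0) k ≡ unitVec k d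
  applyUpTo-indicator zero d = refl
  applyUpTo-indicator (suc k) zero = cong (1 ∷_) (applyUpTo-zeros k)
  applyUpTo-indicator (suc k) (suc d) = cong (0 ∷_) (applyUpTo-indicator k d)

-- a_d: the coefficient of x_{n-1-d} in x_n = c·x_{n-1} + x_{n-2} + ⋯ + x_{n-k}
recCoeff : ℕ → ℕ → ℕ → ℕ
recCoeff c k zero = c
recCoeff c k (suc d) = if suc d <ᵇ k then 1 else 0

recCoeff-pos : ∀ c k d → 0 < d → recCoeff c k d ≡ (if d <ᵇ k then 1 else 0)
recCoeff-pos c k (suc d) _ = refl

step-unitVec : ∀ c k d → step c (2 + k) (unitVec (2 + k) d) ≡ scaleAdd (recCoeff c (2 + k) d) (unitVec (2 + k) 0) (unitVec (2 + k) (suc d))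
step-unitVec c k zero =
  cong₂ _∷_ (cong (λ s → c * 1 + s) (sum-zeros (suc k)))
    (cong₂ _∷_ (sym (cong (_+ 1) (*-zeroʳ c)))
               (trans (take-zeros k) (sym (scaleAdd-zerosˡ c (replicate k 0) (length-replicate k)))))
step-unitVec c k (suc d) =
  cong₂ _∷_ (trans (cong (λ s → c * 0 + s) (sum-unitVec (suc k) d)) (swap c (if d <ᵇ suc k then 1 else 0)))
    (trans (cong (0 ∷_) (take-unitVec k d))
           (sym (scaleAdd-zerosˡ (recCoeff c (2 + k) (suc d)) (unitVec (suc k) (suc d)) (length-unitVec (suc k) (suc d)))))
  where
  swap : ∀ c b → c * 0 + b ≡ b * 1 + 0
  swap = ℕ-Solver.solve-∀

window-shift : ∀ c k d j → let K = 2 + k in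
  window c K (suc d) (suc j) ≡ scaleAdd (recCoeff c K d) (window c K 1 j) (window c K (2 + d) j)
window-shift c k d zero = begin
  window c K (suc d) 1                                  ≡⟨ window-suc c K (suc d) 0 ⟩
  step c K (window c K (suc d) 0)                       ≡⟨ cong (step c K) (window-zero c K d) ⟩
  step c K (unitVec K d)                                ≡⟨ step-unitVec c k d ⟩
  scaleAdd (recCoeff c K d) (unitVec K 0) (unitVec K (suc d))
    ≡⟨ sym (cong₂ (scaleAdd (recCoeff c K d)) (window-zero c K 0) (window-zero c K (suc d))) ⟩
  scaleAdd (recCoeff c K d) (window c K 1 0) (window c K (2 + d) 0) ∎
  where
  open ≡-Reasoning
  K = 2 + k
window-shift c k d (suc j) = begin
  window c K (suc d) (2 + j)                                               ≡⟨ window-suc c K (suc d) (suc j) ⟩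
  step c K (window c K (suc d) (suc j))                                    ≡⟨ cong (step c K) (window-shift c k d j) ⟩
  step c K (scaleAdd (recCoeff c K d) (window c K 1 j) (window c K (2 + d) j))
    ≡⟨ step-scaleAdd c K (recCoeff c K d) (window c K 1 j) (window c K (2 + d) j)
        (length-window-indep c (suc k) 1 (2 + d) j) ⟩
  scaleAdd (recCoeff c K d) (step c K (window c K 1 j)) (step c K (window c K (2 + d) j))
    ≡⟨ sym (cong₂ (scaleAdd (recCoeff c K d)) (window-suc c K 1 j) (window-suc c K (2 + d) j)) ⟩
  scaleAdd (recCoeff c K d) (window c K 1 (suc j)) (window c K (2 + d) (suc j)) ∎
  where
  open ≡-Reasoning
  K = 2 + k

genSeq-shift : ∀ c k d j → let K = 2 + k in
  genSeq c K (suc d) (suc j) ≡ recCoeff c K d * genSeq c K 1 j + genSeq c K (2 + d) j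
genSeq-shift c k d j = begin
  genSeq c K (suc d) (suc j)                                         ≡⟨ genSeq≡head₀ c K (suc d) (suc j) ⟩
  head₀ (window c K (suc d) (suc j))                                 ≡⟨ cong head₀ (window-shift c k d j) ⟩
  head₀ (scaleAdd e (window c K 1 j) (window c K (2 + d) j))
    ≡⟨ head₀-scaleAdd e (window c K 1 j) (window c K (2 + d) j) (length-window-indep c (suc k) 1 (2 + d) j) ⟩
  e * head₀ (window c K 1 j) + head₀ (window c K (2 + d) j)
    ≡⟨ sym (cong₂ (λ a b → e * a + b) (genSeq≡head₀ c K 1 j) (genSeq≡head₀ c K (2 + d) j)) ⟩
  e * genSeq c K 1 j + genSeq c K (2 + d) j ∎
  where
  open ≡-Reasoning
  K = 2 + k
  e = recCoeff c K d

genSeq-one : ∀ c k d → genSeq c (2 + k) (suc d) 1 ≡ recCoeff c (2 + k) d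
genSeq-one c k d = trans (genSeq-shift c k d 0) (trans (+-identityʳ _) (*-identityʳ _))

T-injective : ∀ {a b} → (T a → T b) → (T b → T a) → a ≡ b
T-injective {false} {false} _ _ = refl
T-injective {false} {true} _ b⇒a = ⊥-elim (b⇒a tt)
T-injective {true} {false} a⇒b _ = ⊥-elim (a⇒b tt)
T-injective {true} {true} _ _ = refl

≡ᵇ-refl : ∀ m → (m ≡ᵇ m) ≡ true
≡ᵇ-refl zero = refl
≡ᵇ-refl (suc m) = ≡ᵇ-refl m

≢⇒≡ᵇ-false : ∀ {m n} → m ≢ n → (m ≡ᵇ n) ≡ false
≢⇒≡ᵇ-false {m} {n} m≢n = T-injective (λ t → ⊥-elim (m≢n (≡ᵇ⇒≡ m n t))) λ ()

≤⇒<ᵇ-false : ∀ {m n} → n ≤ m → (m <ᵇ n) ≡ false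
≤⇒<ᵇ-false {m} {n} n≤m = T-injective (λ t → ⊥-elim (<⇒≱ (<ᵇ⇒< m n t) n≤m)) λ ()

<ᵇ-split : ∀ r t → (r <ᵇ t) ≡ (t ≡ᵇ suc r) ∨ (suc r <ᵇ t)
<ᵇ-split zero zero = refl
<ᵇ-split zero (suc zero) = refl
<ᵇ-split zero (suc (suc t)) = refl
<ᵇ-split (suc r) zero = refl
<ᵇ-split (suc r) (suc t) = <ᵇ-split r t

2+m≤n⇒n∸m≡2+[n∸2+m] : ∀ m n → 2 + m ≤ n → n ∸ m ≡ 2 + (n ∸ (2 + m))
2+m≤n⇒n∸m≡2+[n∸2+m] zero (suc (suc n)) _ = refl
2+m≤n⇒n∸m≡2+[n∸2+m] zero (suc zero) (s≤s ())
2+m≤n⇒n∸m≡2+[n∸2+m] (suc m) (suc n) (s≤s 2+m≤n) = 2+m≤n⇒n∸m≡2+[n∸2+m] m n 2+m≤n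

-- H and Hi as functions of ℕ indices, so that index arithmetic carries no Fin bounds.
hEntry : ℕ → ℕ → ℕ → ℕ → G
hEntry lam k a b with a ℕ.≟ b
... | yes _ = fromℕ lam
... | no _ =
  let d = (+ a) ℤ.- (+ b) in
  if (ℤ.-1ℤ ℤ.≤ᵇ d) ∧ ((d ℤ.+ ℤ.1ℤ) ℤ.≤ᵇ (+ k)) then ιpow d else 0G

H≡hEntry : ∀ lam k m (a b : Fin m) → H (+ lam) k m a b ≡ hEntry lam k (toℕ a) (toℕ b)
H≡hEntry lam k m a b with toℕ a ℕ.≟ toℕ b
... | yes _ = refl
... | no _ = refl

hEntry-diag : ∀ lam k a → hEntry lam k a a ≡ fromℕ lam
hEntry-diag lam k a with a ℕ.≟ a
... | yes _ = refl
... | no a≢a = ⊥-elim (a≢a refl)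

hEntry-below : ∀ lam k a b → b < a → hEntry lam k a b ≡ ιpow (+ (a ∸ b)) *G fromℕ (if a ∸ b <ᵇ k then 1 else 0)
hEntry-below lam k a b b<a with a ℕ.≟ b
... | yes a≡b = ⊥-elim (<⇒≢ b<a (sym a≡b))
... | no _ rewrite trans (ℤP.m-n≡m⊖n a b) (ℤP.⊖-≥ (<⇒≤ b<a)) | +-comm (a ∸ b) 1 = if-as-factor _ _

hEntry-super : ∀ lam k a → hEntry lam k a (suc a) ≡ -G ιG
hEntry-super lam k a with a ℕ.≟ suc a
... | yes a≡1+a = ⊥-elim (<⇒≢ (n<1+n a) a≡1+a)
... | no _ rewrite trans (ℤP.m-n≡m⊖n a (suc a)) (trans (ℤP.⊖-< (n<1+n a)) (cong (λ d → ℤ.- (+ d)) (m+n∸n≡m 1 a))) = refl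

hEntry-above : ∀ lam k a b → suc a < b → hEntry lam k a b ≡ 0G
hEntry-above lam k a b 1+a<b with a ℕ.≟ b
... | yes a≡b = ⊥-elim (<⇒≢ (<-trans (n<1+n a) 1+a<b) a≡b)
... | no _ rewrite trans (ℤP.m-n≡m⊖n a b) (ℤP.⊖-< (<-trans (n<1+n a) 1+a<b)) | 2+m≤n⇒n∸m≡2+[n∸2+m] a b 1+a<b = refl

hiEntry : (lam k i n : ℕ) → ℕ → ℕ → G
hiEntry lam k i n zero zero = 1G
hiEntry lam k i n zero (suc zero) = -G ιG
hiEntry lam k i n zero (suc (suc _)) = 0G
hiEntry lam k i n (suc ρ) zero = if (ρ + 2) ≤ᵇ (n ⊓ (k ∸ i + 1)) then ιpow (+ (ρ + 1)) else 0G
hiEntry lam k i n (suc a) (suc b) = hEntry lam k a b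

Hi≡hiEntry : ∀ lam k i n (s t : Fin n) → Hi (+ lam) k i n s t ≡ hiEntry lam k i n (toℕ s) (toℕ t)
Hi≡hiEntry lam k i (suc m) zero zero = refl
Hi≡hiEntry lam k i (suc m) zero (suc zero) = refl
Hi≡hiEntry lam k i (suc m) zero (suc (suc _)) = refl
Hi≡hiEntry lam k i (suc m) (suc r) zero = refl
Hi≡hiEntry lam k i (suc m) (suc a) (suc b) = H≡hEntry lam k m a b

hiEntry-super : ∀ lam k i n r → hiEntry lam k i n r (suc r) ≡ -G ιG
hiEntry-super lam k i n zero = refl
hiEntry-super lam k i n (suc r) = hEntry-super lam k r

hiEntry-above : ∀ lam k i n r t → suc r < t → hiEntry lam k i n r t ≡ 0G
hiEntry-above lam k i n zero (suc (suc t)) _ = refl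
hiEntry-above lam k i n zero (suc zero) (s≤s ())
hiEntry-above lam k i n (suc r) (suc t) (s≤s 1+r<t) = hEntry-above lam k r t 1+r<t

alive : ℕ → ℕ → ℕ → Bool
alive r c t = (t ≡ᵇ c) ∨ (r <ᵇ t)

alive-after-diag : ∀ {r c t} → t ≢ c → alive r c t ≡ alive (suc r) (suc r) t
alive-after-diag {r} {c} {t} t≢c rewrite ≢⇒≡ᵇ-false t≢c = <ᵇ-split r t

alive-after-super : ∀ {r c t} → t ≢ suc r → alive r c t ≡ alive (suc r) c t
alive-after-super {r} {c} {t} t≢1+r rewrite <ᵇ-split r t | ≢⇒≡ᵇ-false t≢1+r = refl

module _ (lam k′ i′ n : ℕ) (i≤k : 2 + i′ ≤ 2 + k′) where
  private
    k i : ℕ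
    k = 2 + k′
    i = 2 + i′

  seqIndex : ℕ → ℕ → ℕ
  seqIndex r zero = r + suc i′
  seqIndex r (suc c) = r ∸ suc c

  firstColumn-cond : ∀ ρ → 2 + ρ ≤ n → ((ρ + 2) ≤ᵇ (n ⊓ (k ∸ i + 1))) ≡ (suc ρ + suc i′ <ᵇ k)
  firstColumn-cond ρ 2+ρ≤n = T-injective to from
    where
    ρ+2≡ρ+1+1 : ρ + 2 ≡ (ρ + 1) + 1
    ρ+2≡ρ+1+1 = sym (+-assoc ρ 1 1)
    ρ+1+i≡3+ρ+i′ : (ρ + 1) + i ≡ suc (suc ρ + suc i′)
    ρ+1+i≡3+ρ+i′ = rearrange ρ i′
      where
      rearrange : ∀ ρ i′ → (ρ + 1) + (2 + i′) ≡ suc (suc ρ + suc i′)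
      rearrange = ℕ-Solver.solve-∀
    to : T ((ρ + 2) ≤ᵇ (n ⊓ (k ∸ i + 1))) → T (suc ρ + suc i′ <ᵇ k)
    to t = <⇒<ᵇ (subst (_≤ k) ρ+1+i≡3+ρ+i′ (m≤o∸n⇒m+n≤o (ρ + 1) i≤k
             (+-cancelʳ-≤ 1 (ρ + 1) (k ∸ i) (subst (_≤ k ∸ i + 1) ρ+2≡ρ+1+1
               (m≤n⊓o⇒m≤o n (k ∸ i + 1) (≤ᵇ⇒≤ (ρ + 2) _ t))))))
    from : T (suc ρ + suc i′ <ᵇ k) → T ((ρ + 2) ≤ᵇ (n ⊓ (k ∸ i + 1)))
    from t = ≤⇒≤ᵇ (⊓-glb (subst (_≤ n) (+-comm 2 ρ) 2+ρ≤n)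
               (subst (_≤ k ∸ i + 1) (sym ρ+2≡ρ+1+1) (+-monoˡ-≤ 1 (m+n≤o⇒m≤o∸n (ρ + 1)
                 (subst (_≤ k) (sym ρ+1+i≡3+ρ+i′) (<ᵇ⇒< _ k t))))))

  hiEntry-lower : ∀ r c → c ≤ r → r < n →
    hiEntry lam k i n r c ≡ ιpow (+ (r ∸ c)) *G fromℕ (recCoeff lam k (seqIndex r c))
  hiEntry-lower zero zero _ _ rewrite Equivalence.to T-≡ (<⇒<ᵇ i≤k) = refl
  hiEntry-lower (suc ρ) zero _ ρ<n =
    trans (cong₂ (λ b e → if b then ιpow (+ e) else 0G) (firstColumn-cond ρ ρ<n) (+-comm ρ 1)) (if-as-factor _ _)
  hiEntry-lower (suc ρ) (suc b) (s≤s b≤ρ) _ with b ℕ.≟ ρ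
  ... | yes refl rewrite n∸n≡0 b = trans (hEntry-diag lam k b) (sym (*G-identityˡ _))
  ... | no b≢ρ = trans (hEntry-below lam k ρ b b<ρ)
                   (cong (λ e → ιpow (+ (ρ ∸ b)) *G fromℕ e) (sym (recCoeff-pos lam k (ρ ∸ b) (m<n⇒0<n∸m b<ρ))))
    where
    b<ρ : b < ρ
    b<ρ = ≤∧≢⇒< b≤ρ b≢ρ

  -- M(r,c), with the dropped columns zeroed; row s of the minor is row s + r of H^i.
  minor : ∀ {j} → ℕ → ℕ → RectMatrix j n
  minor r c = masked (alive r c) (λ s t → hiEntry lam k i n (toℕ s + r) (toℕ t))

  minor-tail : ∀ {j} r (s : Fin j) (t : Fin n) →
    hiEntry lam k i n (toℕ (suc s) + r) (toℕ t) ≡ hiEntry lam k i n (toℕ s + suc r) (toℕ t)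
  minor-tail r s t = cong (λ a → hiEntry lam k i n a (toℕ t)) (sym (+-suc (toℕ s) r))

  deleteCol-minor-diag : ∀ {j} r c (x : Fin n) → c ≤ r → toℕ x ≡ c →
    ∀ s t → deleteCol x (minor {suc j} r c ∘ suc) s t ≡ minor (suc r) (suc r) s t
  deleteCol-minor-diag r c x c≤r x≡c = deleteCol-masked x dead
    (λ t t≢x → alive-after-diag (subst (t ≢_) x≡c t≢x)) (minor-tail r)
    where
    dead : alive (suc r) (suc r) (toℕ x) ≡ false
    dead rewrite x≡c | ≢⇒≡ᵇ-false (<⇒≢ (s≤s c≤r)) | ≤⇒<ᵇ-false (m≤n⇒m≤1+n c≤r) = refl

  deleteCol-minor-super : ∀ {j} r c (x : Fin n) → c ≤ r → toℕ x ≡ suc r →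
    ∀ s t → deleteCol x (minor {suc j} r c ∘ suc) s t ≡ minor (suc r) c s t
  deleteCol-minor-super r c x c≤r x≡1+r = deleteCol-masked x dead
    (λ t t≢x → alive-after-super (subst (t ≢_) x≡1+r t≢x)) (minor-tail r)
    where
    dead : alive (suc r) c (toℕ x) ≡ false
    dead rewrite x≡1+r | ≢⇒≡ᵇ-false (≢-sym (<⇒≢ (s≤s c≤r))) | ≤⇒<ᵇ-false (≤-refl {r}) = refl

  minor-row₀-diag : ∀ {j} r c (x : Fin n) → toℕ x ≡ c → minor {suc j} r c zero x ≡ hiEntry lam k i n r c
  minor-row₀-diag r c x refl rewrite ≡ᵇ-refl (toℕ x) = refl

  minor-row₀-super : ∀ {j} r c (x : Fin n) → toℕ x ≡ suc r → minor {suc j} r c zero x ≡ -G ιG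
  minor-row₀-super r c x x≡1+r rewrite x≡1+r | Equivalence.to T-≡ (<⇒<ᵇ (n<1+n r)) | ∨-zeroʳ (suc r ≡ᵇ c) = hiEntry-super lam k i n r

  minor-row₀-other : ∀ {j} r c (x : Fin n) → toℕ x ≢ c → toℕ x ≢ suc r → minor {suc j} r c zero x ≡ 0G
  minor-row₀-other r c x x≢c x≢1+r with toℕ x ℕ.≤? r
  ... | yes x≤r rewrite ≢⇒≡ᵇ-false x≢c | ≤⇒<ᵇ-false x≤r = refl
  ... | no x≰r with alive r c (toℕ x)
  ...   | false = refl
  ...   | true = hiEntry-above lam k i n r (toℕ x) (≤∧≢⇒< (≰⇒> x≰r) (≢-sym x≢1+r))

  seqIndex-suc : ∀ r c → c ≤ r → seqIndex (suc r) c ≡ suc (seqIndex r c)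
  seqIndex-suc r zero _ = refl
  seqIndex-suc r (suc b) 1+b≤r = +-∸-assoc 1 1+b≤r

  firstRowTerm : ℕ → ℕ → ℕ → Fin n → G
  firstRowTerm j r c x = minor {suc j} r c zero x *G rectPer (deleteCol x (minor {suc j} r c ∘ suc))

  firstRowTerm-other : ∀ {j} r c (x : Fin n) → toℕ x ≢ c → toℕ x ≢ suc r → firstRowTerm j r c x ≡ 0G
  firstRowTerm-other {j} r c x x≢c x≢1+r =
    trans (cong (_*G rectPer (deleteCol x (minor {suc j} r c ∘ suc))) (minor-row₀-other {j} r c x x≢c x≢1+r))
          (*G-zeroˡ (rectPer (deleteCol x (minor {suc j} r c ∘ suc))))

  minor-single : ∀ r c → c ≤ r → n ≡ suc r → rectPer (minor {1} r c) ≡ hiEntry lam k i n r c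
  minor-single r c c≤r n≡1+r = begin
    rectPer (minor {1} r c)                  ≡⟨ rectPer-expand (minor r c) ⟩
    sumG (tabulate (firstRowTerm 0 r c))     ≡⟨ sumG-tabulate-single (firstRowTerm 0 r c) p others ⟩
    minor {1} r c zero p *G 1G               ≡⟨ *G-identityʳ _ ⟩
    minor {1} r c zero p                     ≡⟨ minor-row₀-diag {0} r c p (toℕ-fromℕ< c<n) ⟩
    hiEntry lam k i n r c                    ∎
    where
    open ≡-Reasoning
    c<n : c < n
    c<n = subst (c <_) (sym n≡1+r) (s≤s c≤r)
    p : Fin n
    p = fromℕ< c<n
    others : ∀ x → x ≢ p → firstRowTerm 0 r c x ≡ 0G
    others x x≢p = firstRowTerm-other {0} r c x (≢-fromℕ< c<n x≢p)
      (λ x≡1+r → <⇒≢ (toℕ<n x) (trans x≡1+r (sym n≡1+r)))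

  minor-expand : ∀ j r c → c ≤ r → suc r < n →
    rectPer (minor {2 + j} r c) ≡ (hiEntry lam k i n r c *G rectPer (minor {suc j} (suc r) (suc r)))
                                   +G ((-G ιG) *G rectPer (minor {suc j} (suc r) c))
  minor-expand j r c c≤r 1+r<n = begin
    rectPer (minor {2 + j} r c)                                ≡⟨ rectPer-expand (minor r c) ⟩
    sumG (tabulate (firstRowTerm (suc j) r c))                 ≡⟨ sumG-tabulate-pair (firstRowTerm (suc j) r c) p q p≢q others ⟩
    firstRowTerm (suc j) r c p +G firstRowTerm (suc j) r c q   ≡⟨ cong₂ _+G_ term-p term-q ⟩
    (hiEntry lam k i n r c *G rectPer (minor {suc j} (suc r) (suc r))) +G ((-G ιG) *G rectPer (minor {suc j} (suc r) c)) ∎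
    where
    open ≡-Reasoning
    c<n : c < n
    c<n = ≤-<-trans c≤r (<-trans (n<1+n r) 1+r<n)
    p q : Fin n
    p = fromℕ< c<n
    q = fromℕ< 1+r<n
    p≢q : p ≢ q
    p≢q p≡q = <⇒≢ (s≤s c≤r) (trans (sym (toℕ-fromℕ< c<n)) (trans (cong toℕ p≡q) (toℕ-fromℕ< 1+r<n)))
    others : ∀ x → x ≢ p → x ≢ q → firstRowTerm (suc j) r c x ≡ 0G
    others x x≢p x≢q = firstRowTerm-other {suc j} r c x (≢-fromℕ< c<n x≢p) (≢-fromℕ< 1+r<n x≢q)
    term-p : firstRowTerm (suc j) r c p ≡ hiEntry lam k i n r c *G rectPer (minor {suc j} (suc r) (suc r))
    term-p = cong₂ _*G_ (minor-row₀-diag {suc j} r c p (toℕ-fromℕ< c<n))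
                        (rectPer-cong (deleteCol-minor-diag {suc j} r c p c≤r (toℕ-fromℕ< c<n)))
    term-q : firstRowTerm (suc j) r c q ≡ (-G ιG) *G rectPer (minor {suc j} (suc r) c)
    term-q = cong₂ _*G_ (minor-row₀-super {suc j} r c q (toℕ-fromℕ< 1+r<n))
                        (rectPer-cong (deleteCol-minor-super {suc j} r c q c≤r (toℕ-fromℕ< 1+r<n)))

  minor-per : ∀ j r c → c ≤ r → n ≡ r + suc j →
    rectPer (minor {suc j} r c) ≡ ιpow (+ (r ∸ c)) *G fromℕ (genSeq lam k (suc (seqIndex r c)) (suc j))
  minor-per zero r c c≤r n≡r+1 = begin
    rectPer (minor {1} r c)                                     ≡⟨ minor-single r c c≤r (trans n≡r+1 (+-comm r 1)) ⟩
    hiEntry lam k i n r c                                       ≡⟨ hiEntry-lower r c c≤r r<n ⟩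
    ιpow (+ (r ∸ c)) *G fromℕ (recCoeff lam k (seqIndex r c))
      ≡⟨ cong (λ e → ιpow (+ (r ∸ c)) *G fromℕ e) (sym (genSeq-one lam k′ (seqIndex r c))) ⟩
    ιpow (+ (r ∸ c)) *G fromℕ (genSeq lam k (suc (seqIndex r c)) 1) ∎
    where
    open ≡-Reasoning
    r<n : r < n
    r<n = subst (r <_) (sym (trans n≡r+1 (+-comm r 1))) (n<1+n r)
  minor-per (suc j) r c c≤r n≡r+2+j = begin
    rectPer (minor {2 + j} r c)
      ≡⟨ minor-expand j r c c≤r 1+r<n ⟩
    (hiEntry lam k i n r c *G rectPer (minor {suc j} (suc r) (suc r))) +G ((-G ιG) *G rectPer (minor {suc j} (suc r) c))
      ≡⟨ cong₂ (λ a b → (a *G b) +G ((-G ιG) *G rectPer (minor {suc j} (suc r) c))) (hiEntry-lower r c c≤r r<n) per-diag ⟩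
    ((P *G X) *G Y) +G ((-G ιG) *G rectPer (minor {suc j} (suc r) c))
      ≡⟨ cong (λ a → ((P *G X) *G Y) +G ((-G ιG) *G a)) per-super ⟩
    ((P *G X) *G Y) +G ((-G ιG) *G ((ιG *G P) *G Z))
      ≡⟨ cong₂ _+G_ (*G-assoc P X Y) (ι-cancel P Z) ⟩
    (P *G (X *G Y)) +G (P *G Z)
      ≡⟨ sym (*G-distribˡ-+G P (X *G Y) Z) ⟩
    P *G ((X *G Y) +G Z)
      ≡⟨ cong (P *G_) (sym (trans (fromℕ-+ (e * g 1) (g (2 + d))) (cong (_+G Z) (fromℕ-* e (g 1))))) ⟩
    P *G fromℕ (e * g 1 + g (2 + d))
      ≡⟨ cong (λ m → P *G fromℕ m) (sym (genSeq-shift lam k′ d (suc j))) ⟩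
    P *G fromℕ (genSeq lam k (suc d) (2 + j)) ∎
    where
    open ≡-Reasoning
    d e : ℕ
    d = seqIndex r c
    e = recCoeff lam k d
    g : ℕ → ℕ
    g a = genSeq lam k a (suc j)
    P X Y Z : G
    P = ιpow (+ (r ∸ c))
    X = fromℕ e
    Y = fromℕ (g 1)
    Z = fromℕ (g (2 + d))
    n≡1+r+1+j : n ≡ suc r + suc j
    n≡1+r+1+j = trans n≡r+2+j (+-suc r (suc j))
    1+r<n : suc r < n
    1+r<n = subst (suc r <_) (sym n≡1+r+1+j) (m<m+n (suc r) (s≤s z≤n))
    r<n : r < n
    r<n = <-trans (n<1+n r) 1+r<n
    per-diag : rectPer (minor {suc j} (suc r) (suc r)) ≡ Y
    per-diag = trans (minor-per j (suc r) (suc r) ≤-refl n≡1+r+1+j)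
      (trans (cong₂ (λ a b → ιpow (+ a) *G fromℕ (genSeq lam k (suc b) (suc j))) (n∸n≡0 r) (n∸n≡0 r)) (*G-identityˡ Y))
    per-super : rectPer (minor {suc j} (suc r) c) ≡ (ιG *G P) *G Z
    per-super = trans (minor-per j (suc r) c (m≤n⇒m≤1+n c≤r) n≡1+r+1+j)
      (cong₂ (λ a b → ιpow (+ a) *G fromℕ (genSeq lam k (suc b) (suc j))) (+-∸-assoc 1 c≤r) (seqIndex-suc r c c≤r))

per-Hi : ∀ lam k′ i′ j → 2 + i′ ≤ 2 + k′ →
  per (Hi (+ lam) (2 + k′) (2 + i′) (suc j)) ≡ fromℕ (genSeq lam (2 + k′) (2 + i′) (suc j))
per-Hi lam k′ i′ j i≤k = begin
  per (Hi (+ lam) k i n)                                   ≡⟨ per≡rectPer (Hi (+ lam) k i n) ⟩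
  rectPer (Hi (+ lam) k i n)                               ≡⟨ rectPer-cong Hi≡minor₀₀ ⟩
  rectPer (minor lam k′ i′ n i≤k {n} 0 0)                  ≡⟨ minor-per lam k′ i′ n i≤k j 0 0 z≤n refl ⟩
  1G *G fromℕ (genSeq lam k i n)                           ≡⟨ *G-identityˡ (fromℕ (genSeq lam k i n)) ⟩
  fromℕ (genSeq lam k i n)                                 ∎
  where
  open ≡-Reasoning
  k i n : ℕ
  k = 2 + k′
  i = 2 + i′
  n = suc j
  alive₀₀ : ∀ t → alive 0 0 t ≡ true
  alive₀₀ zero = refl
  alive₀₀ (suc t) = refl
  Hi≡minor₀₀ : ∀ s t → Hi (+ lam) k i n s t ≡ minor lam k′ i′ n i≤k 0 0 s t
  Hi≡minor₀₀ s t rewrite alive₀₀ (toℕ t) | +-identityʳ (toℕ s) = Hi≡hiEntry lam k i n s t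

corollary1p22 : (k i n : ℕ) → 2 ≤ k → 2 ≤ i → i ≤ k → 3 ≤ n →
    (per (Hi (+ 1) k i n) ≡ fromℕ (fib k i n)) × (per (Hi (+ 2) k i n) ≡ fromℕ (pell k i n))
corollary1p22 (suc (suc k′)) (suc (suc i′)) (suc j) (s≤s (s≤s z≤n)) (s≤s (s≤s z≤n)) i≤k (s≤s _) =
  per-Hi 1 k′ i′ j i≤k , per-Hi 2 k′ i′ j i≤k
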